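{- Let $A$ be a commutative ring with $1$, let $M \in \operatorname{Sym}_n(A)$ and let $a \in (\Sigma(M):A^n)$. Then $b^2 \in (\Sigma(M):A^n)$ for all $b \in \Sigma(a)$.
   Context: $\operatorname{Sym}_n(A)$ is the set of symmetric $n\times n$ matrices over $A$. $\Sigma A^2$ denotes the set of finite sums of squares of elements of $A$. A matrix $N\in\operatorname{Sym}_n(A)$ is called a sum of squares if $N=Q^tQ$ for some $Q\in\operatorname{Mat}_{m,n}(A)$ and some $m$. For $M\in\operatorname{Sym}_n(A)$, $\Sigma(M)$ is the set of all $v\in A^n$ (viewed as row vectors, so that $v^tv$ is the $n\times n$ matrix $(v_iv_j)_{i,j}$) such that $sM = v^tv + N$ for some $s\in\Sigma A^2$ and some $N\in\operatorname{Sym}_n(A)$ that is a sum of squares; it is an $A$-submodule of $A^n$. $(\Sigma(M):A^n)=\{c\in A : cv\in\Sigma(M) \text{ for all } v\in A^n\}$. For $a\in A$ regarded as a $1\times 1$ matrix, $\Sigma(a)$ is the set of $b\in A$ with $sa=b^2+r$ for some $s,r\in\Sigma A^2$. -}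

module Defs where

open import Level using (Level; _⊔_)
open import Algebra.Bundles using (CommutativeRing)
open import Data.Nat.Base using (ℕ)
import Data.Nat.Base as ℕ
open import Data.Fin.Base using (Fin; zero; suc)
open import Data.Product using (Σ; ∃; _×_; _,_)

module SOS {c ℓ : Level} (R : CommutativeRing c ℓ) where
  open CommutativeRing R using (Carrier; _≈_; _+_; _*_; 0#)

  ∑ : {m : ℕ} → (Fin m → Carrier) → Carrier
  ∑ {ℕ.zero}  f = 0#
  ∑ {ℕ.suc m} f = f zero + ∑ (λ k → f (suc k))

  IsSumOfSquares : Carrier → Set (c ⊔ ℓ)
  IsSumOfSquares s = ∃ λ (m : ℕ) → Σ (Fin m → Carrier) λ x → s ≈ ∑ (λ k → x k * x k)

  Mat : ℕ → Set c
  Mat n = Fin n → Fin n → Carrier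

  IsSymmetric : {n : ℕ} → Mat n → Set ℓ
  IsSymmetric M = ∀ i j → M i j ≈ M j i

  IsSOSMatrix : {n : ℕ} → Mat n → Set (c ⊔ ℓ)
  IsSOSMatrix {n} N =
    ∃ λ (m : ℕ) → Σ (Fin m → Fin n → Carrier) λ Q →
      ∀ i j → N i j ≈ ∑ (λ k → Q k i * Q k j)

  InΣ : {n : ℕ} → Mat n → (Fin n → Carrier) → Set (c ⊔ ℓ)
  InΣ {n} M v =
    Σ Carrier λ s → Σ (Mat n) λ N →
      IsSumOfSquares s × IsSOSMatrix N ×
      (∀ i j → s * M i j ≈ v i * v j + N i j)

  InColon : {n : ℕ} → Mat n → Carrier → Set (c ⊔ ℓ)
  InColon {n} M a = (v : Fin n → Carrier) → InΣ M (λ i → a * v i)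

  -- Σ(a) for a ∈ A (as 1×1 matrix): s a = b² + r, s, r ∈ ΣA²
  InΣ₁ : Carrier → Carrier → Set (c ⊔ ℓ)
  InΣ₁ a b = Σ Carrier λ s → Σ Carrier λ r →
    IsSumOfSquares s × IsSumOfSquares r × (s * a ≈ b * b + r)

{-# OPTIONS --safe #-}
-- If t M = (a v)ᵗ(a v) + N and s a = b² + r, then multiplying by s² gives
-- s² t M = (s a v)ᵗ(s a v) + s² N, and (s a)² = b⁴ + r (2 b² + r).  The surplus
-- r (2 b² + r) vᵗv is a sum-of-squares matrix, so it can be absorbed into s² N,
-- leaving (b² v)ᵗ(b² v) as the rank-one part.
module Submission where

open import Defs
open import Level using (Level)
open import Algebra.Bundles using (CommutativeRing)
open import Data.Nat.Base using (ℕ; zero; suc)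
open import Data.Fin.Base using (Fin; zero; suc; splitAt)
open import Data.Product using (_,_)
open import Data.Sum.Properties using ([,]-map)
open import Data.Vec.Functional using (Vector; _++_)
open import Function.Base using (_∘_)
import Relation.Binary.PropositionalEquality as ≡
import Relation.Binary.Reasoning.Setoid as SetoidReasoning

module SumsOfSquares {c ℓ : Level} (R : CommutativeRing c ℓ) where
  open CommutativeRing R hiding (zero)
  open SOS R
  open import Algebra.Solver.Ring.NaturalCoefficients.Default commutativeSemiring
    using (solve; _:=_; _:+_; _:*_)
  open SetoidReasoning setoid

  ∑-cong : ∀ {m} {f g : Fin m → Carrier} → (∀ k → f k ≈ g k) → ∑ f ≈ ∑ g
  ∑-cong {zero}  f≈g = refl
  ∑-cong {suc m} f≈g = +-cong (f≈g zero) (∑-cong (f≈g ∘ suc))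

  *-distribˡ-∑ : ∀ {m} d (f : Fin m → Carrier) → d * ∑ f ≈ ∑ (λ k → d * f k)
  *-distribˡ-∑ {zero}  d f = zeroʳ d
  *-distribˡ-∑ {suc m} d f = trans (distribˡ d _ _) (+-congˡ (*-distribˡ-∑ d (f ∘ suc)))

  ∑-++ : ∀ {A : Set c} {m m′} (F : A → Carrier) (xs : Vector A m) (ys : Vector A m′) →
         ∑ (F ∘ (xs ++ ys)) ≈ ∑ (F ∘ xs) + ∑ (F ∘ ys)
  ∑-++ {m = zero}  F xs ys = sym (+-identityˡ _)
  ∑-++ {m = suc m} F xs ys = begin
    F (xs zero) + ∑ (F ∘ (xs ++ ys) ∘ suc)        ≈⟨ +-congˡ (∑-cong λ k → reflexive (≡.cong F ([,]-map (splitAt m k)))) ⟩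
    F (xs zero) + ∑ (F ∘ (xs ∘ suc ++ ys))        ≈⟨ +-congˡ (∑-++ F (xs ∘ suc) ys) ⟩
    F (xs zero) + (∑ (F ∘ xs ∘ suc) + ∑ (F ∘ ys)) ≈⟨ +-assoc _ _ _ ⟨
    ∑ (F ∘ xs) + ∑ (F ∘ ys)                       ∎

  IsSOSMatrix-resp : ∀ {n} {N N′ : Mat n} → (∀ i j → N i j ≈ N′ i j) →
                     IsSOSMatrix N → IsSOSMatrix N′
  IsSOSMatrix-resp N≈N′ (m , Q , N≈QᵗQ) = m , Q , λ i j → trans (sym (N≈N′ i j)) (N≈QᵗQ i j)

  IsSOSMatrix-0 : ∀ {n} → IsSOSMatrix {n} (λ _ _ → 0#)
  IsSOSMatrix-0 = 0 , (λ ()) , λ _ _ → refl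

  IsSOSMatrix-outer : ∀ {n} (w : Fin n → Carrier) → IsSOSMatrix (λ i j → w i * w j)
  IsSOSMatrix-outer w = 1 , (λ _ → w) , λ _ _ → sym (+-identityʳ _)

  IsSOSMatrix-+ : ∀ {n} {N N′ : Mat n} → IsSOSMatrix N → IsSOSMatrix N′ →
                  IsSOSMatrix (λ i j → N i j + N′ i j)
  IsSOSMatrix-+ (m , Q , N≈QᵗQ) (m′ , Q′ , N′≈Q′ᵗQ′) = _ , Q ++ Q′ , λ i j →
    trans (+-cong (N≈QᵗQ i j) (N′≈Q′ᵗQ′ i j)) (sym (∑-++ (λ q → q i * q j) Q Q′))

  IsSOSMatrix-square-* : ∀ {n} d {N : Mat n} → IsSOSMatrix N →
                         IsSOSMatrix (λ i j → (d * d) * N i j)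
  IsSOSMatrix-square-* d {N} (m , Q , N≈QᵗQ) = m , (λ k i → d * Q k i) , λ i j → begin
    (d * d) * N i j                         ≈⟨ *-congˡ (N≈QᵗQ i j) ⟩
    (d * d) * ∑ (λ k → Q k i * Q k j)       ≈⟨ *-distribˡ-∑ (d * d) (λ k → Q k i * Q k j) ⟩
    ∑ (λ k → (d * d) * (Q k i * Q k j))     ≈⟨ ∑-cong (λ k → square-* d (Q k i) (Q k j)) ⟩
    ∑ (λ k → (d * Q k i) * (d * Q k j))     ∎
    where
    square-* : ∀ d x y → (d * d) * (x * y) ≈ (d * x) * (d * y)
    square-* = solve 3 (λ d x y → (d :* d) :* (x :* y) := (d :* x) :* (d :* y)) refl

  IsSOSMatrix-sos-* : ∀ {n} {s} {N : Mat n} → IsSumOfSquares s → IsSOSMatrix N →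
                      IsSOSMatrix (λ i j → s * N i j)
  IsSOSMatrix-sos-* {N = N} (m , x , s≈∑x²) N-sos =
    IsSOSMatrix-resp (λ _ _ → *-congʳ (sym s≈∑x²)) (∑-squares-* x)
    where
    ∑-squares-* : ∀ {m} (x : Fin m → Carrier) → IsSOSMatrix (λ i j → ∑ (λ k → x k * x k) * N i j)
    ∑-squares-* {zero}  x = IsSOSMatrix-resp (λ _ _ → sym (zeroˡ _)) IsSOSMatrix-0
    ∑-squares-* {suc m} x = IsSOSMatrix-resp (λ _ _ → sym (distribʳ _ _ _))
      (IsSOSMatrix-+ (IsSOSMatrix-square-* (x zero) N-sos) (∑-squares-* (x ∘ suc)))

  IsSumOfSquares⇒IsSOSMatrix₁ : ∀ {s} → IsSumOfSquares s → IsSOSMatrix {1} (λ _ _ → s)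
  IsSumOfSquares⇒IsSOSMatrix₁ (m , x , s≈∑x²) = m , (λ k _ → x k) , λ _ _ → s≈∑x²

  IsSOSMatrix₁⇒IsSumOfSquares : ∀ {s} → IsSOSMatrix {1} (λ _ _ → s) → IsSumOfSquares s
  IsSOSMatrix₁⇒IsSumOfSquares (m , Q , s≈QᵗQ) = m , (λ k → Q k zero) , s≈QᵗQ zero zero

  IsSumOfSquares-square : ∀ x → IsSumOfSquares (x * x)
  IsSumOfSquares-square x = IsSOSMatrix₁⇒IsSumOfSquares (IsSOSMatrix-outer (λ _ → x))

  IsSumOfSquares-+ : ∀ {s t} → IsSumOfSquares s → IsSumOfSquares t → IsSumOfSquares (s + t)
  IsSumOfSquares-+ s-sos t-sos = IsSOSMatrix₁⇒IsSumOfSquares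
    (IsSOSMatrix-+ (IsSumOfSquares⇒IsSOSMatrix₁ s-sos) (IsSumOfSquares⇒IsSOSMatrix₁ t-sos))

  IsSumOfSquares-* : ∀ {s t} → IsSumOfSquares s → IsSumOfSquares t → IsSumOfSquares (s * t)
  IsSumOfSquares-* s-sos t-sos = IsSOSMatrix₁⇒IsSumOfSquares
    (IsSOSMatrix-sos-* s-sos (IsSumOfSquares⇒IsSOSMatrix₁ t-sos))

  module _ {n} {M : Mat n} where

    InΣ-resp : ∀ {v w} → (∀ i → v i ≈ w i) → InΣ M v → InΣ M w
    InΣ-resp v≈w (t , N , t-sos , N-sos , tM≈vᵗv+N) = t , N , t-sos , N-sos , λ i j →
      trans (tM≈vᵗv+N i j) (+-congʳ (*-cong (v≈w i) (v≈w j)))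

    InΣ-*ˡ : ∀ d {v} → InΣ M v → InΣ M (λ i → d * v i)
    InΣ-*ˡ d {v} (t , N , t-sos , N-sos , tM≈vᵗv+N) =
      (d * d) * t , _ ,
      IsSumOfSquares-* (IsSumOfSquares-square d) t-sos , IsSOSMatrix-square-* d N-sos ,
      λ i j → begin
        ((d * d) * t) * M i j                   ≈⟨ *-assoc _ _ _ ⟩
        (d * d) * (t * M i j)                   ≈⟨ *-congˡ (tM≈vᵗv+N i j) ⟩
        (d * d) * (v i * v j + N i j)           ≈⟨ scale (v i) (v j) (N i j) ⟩
        (d * v i) * (d * v j) + (d * d) * N i j ∎
      where
      scale : ∀ x y z → (d * d) * (x * y + z) ≈ (d * x) * (d * y) + (d * d) * z
      scale = solve 4 (λ d x y z → (d :* d) :* (x :* y :+ z) := (d :* x) :* (d :* y) :+ (d :* d) :* z) refl d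

    -- The surplus e vᵗv is absorbed into the sum-of-squares matrix part.
    InΣ-square-dominated : ∀ c x v {e} → IsSumOfSquares e → c * c ≈ x * x + e →
                           InΣ M (λ i → c * v i) → InΣ M (λ i → x * v i)
    InΣ-square-dominated c x v {e} e-sos c²≈x²+e (t , N , t-sos , N-sos , tM≈cvᵗcv+N) =
      t , _ , t-sos ,
      IsSOSMatrix-+ (IsSOSMatrix-sos-* e-sos (IsSOSMatrix-outer v)) N-sos ,
      λ i j → begin
        t * M i j                                         ≈⟨ tM≈cvᵗcv+N i j ⟩
        (c * v i) * (c * v j) + N i j                     ≈⟨ +-congʳ (regroup c c (v i) (v j)) ⟩
        (c * c) * (v i * v j) + N i j                     ≈⟨ +-congʳ (*-congʳ c²≈x²+e) ⟩
        (x * x + e) * (v i * v j) + N i j                 ≈⟨ +-congʳ (distribʳ _ _ _) ⟩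
        (x * x) * (v i * v j) + e * (v i * v j) + N i j   ≈⟨ +-congʳ (+-congʳ (sym (regroup x x (v i) (v j)))) ⟩
        (x * v i) * (x * v j) + e * (v i * v j) + N i j   ≈⟨ +-assoc _ _ _ ⟩
        (x * v i) * (x * v j) + (e * (v i * v j) + N i j) ∎
      where
      regroup : ∀ c d x y → (c * x) * (d * y) ≈ (c * d) * (x * y)
      regroup = solve 4 (λ c d x y → (c :* x) :* (d :* y) := (c :* d) :* (x :* y)) refl

    InΣ-drop-sos : ∀ {x r} v → IsSumOfSquares x → IsSumOfSquares r →
                   InΣ M (λ i → (x + r) * v i) → InΣ M (λ i → x * v i)
    InΣ-drop-sos {x} {r} v x-sos r-sos =
      InΣ-square-dominated (x + r) x v
        (IsSumOfSquares-* r-sos (IsSumOfSquares-+ (IsSumOfSquares-+ x-sos x-sos) r-sos))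
        (expand x r)
      where
      expand : ∀ x r → (x + r) * (x + r) ≈ x * x + r * ((x + x) + r)
      expand = solve 2 (λ x r → (x :+ r) :* (x :+ r) := x :* x :+ r :* ((x :+ x) :+ r)) refl

corollary3p10 : {c ℓ : Level} (R : CommutativeRing c ℓ) (n : ℕ)
    (M : SOS.Mat R n) → SOS.IsSymmetric R M →
    (a : CommutativeRing.Carrier R) → SOS.InColon R M a →
    (b : CommutativeRing.Carrier R) → SOS.InΣ₁ R a b →
    SOS.InColon R M (CommutativeRing._*_ R b b)
corollary3p10 R n M _ a av∈ΣM b (s , r , _ , r-sos , sa≈b²+r) v =
  InΣ-drop-sos v (IsSumOfSquares-square b) r-sos
    (InΣ-resp (λ i → trans (sym (*-assoc s a (v i))) (*-congʳ sa≈b²+r))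
      (InΣ-*ˡ s (av∈ΣM v)))
  where
  open CommutativeRing R
  open SumsOfSquares R
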